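{- Let $F\in\mathbf{AF}$ be isomorphic to the Fraïssé quiver and let $Q\in\mathbf{AF}$ be arbitrary. Then there exists $\mathbf i=(i_1,i_2,\dots)\in\mathbb{N}^{\mathbb{N}}$ such that the sequence $(\mu_{i_m}\circ\cdots\circ\mu_{i_1}(F))_{m\ge1}$ converges to $Q$ in $\mathbf{AF}$.
   Context: $\mathbb{N}$ is the positive integers. A quiver on a set $X$ is a function $Q:X\times X\to\mathbb{Z}$ with $Q(x,y)=-Q(y,x)$. $\mathbf{AF}$ is the set of quivers on $\mathbb{N}$ with the topology generated by the basic sets $U_{Q,V}=\{Q':Q'(x,y)=Q(x,y)\text{ for all }x,y\in V\}$, $V\subseteq\mathbb{N}$ finite. Mutation at $x$: $\mu_x(Q)(v,w)=-Q(v,w)$ if $x\in\{v,w\}$, otherwise $Q(v,w)+Q(v,x)[Q(x,w)]_++[-Q(v,x)]_+Q(x,w)$, $[a]_+=\max(a,0)$. A quiver $Q$ is homogeneous if every isomorphism between full subquivers (restrictions of $Q$ to vertex subsets) on finite vertex sets extends to an automorphism of $Q$. The Fraïssé quiver is the unique (up to isomorphism) countable homogeneous quiver into which every quiver on a finite vertex set embeds as a full subquiver (the Fraïssé limit of the class of all quivers on finite vertex sets). -}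

module Defs where

open import Data.Nat using (ℕ; zero; suc; _≤_; _≟_)
open import Data.Integer using (ℤ; -_; _+_; _*_; _⊔_; 0ℤ)
open import Data.Fin using (Fin)
open import Data.List using (List)
open import Data.List.Membership.Propositional using (_∈_)
open import Data.Product using (Σ; _×_; ∃; ∃-syntax)
open import Data.Sum using (_⊎_)
open import Relation.Nullary using (yes; no)
open import Relation.Binary.PropositionalEquality using (_≡_)
open import Function.Definitions using (Injective)

-- Vertex set ℕ of the paper (positive integers) is modelled by Agda's ℕ
-- (starting at 0); this is a relabelling of the countable vertex set.

RawQuiver : Set → Set
RawQuiver X = X → X → ℤ

IsQuiver : {X : Set} → RawQuiver X → Set
IsQuiver {X} Q = (x y : X) → Q x y ≡ - Q y x

[_]₊ : ℤ → ℤ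
[ a ]₊ = a ⊔ 0ℤ

μ : ℕ → RawQuiver ℕ → RawQuiver ℕ
μ x Q v w with v ≟ x | w ≟ x
... | yes _ | _     = - Q v w
... | no _  | yes _ = - Q v w
... | no _  | no _  = Q v w + (Q v x * [ Q x w ]₊ + [ - Q v x ]₊ * Q x w)

mutSeq : RawQuiver ℕ → (ℕ → ℕ) → ℕ → RawQuiver ℕ
mutSeq F i zero    = F
mutSeq F i (suc m) = μ (i m) (mutSeq F i m)

-- Convergence in AF: every basic neighbourhood U_{Q,V} (V finite) of Q
-- eventually contains the sequence.
ConvergesTo : (ℕ → RawQuiver ℕ) → RawQuiver ℕ → Set
ConvergesTo Qs Q =
  (V : List ℕ) → ∃[ M ] ((m : ℕ) → M ≤ m →
     (x y : ℕ) → x ∈ V → y ∈ V → Qs m x y ≡ Q x y)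

IsAutomorphism : RawQuiver ℕ → (ℕ → ℕ) → (ℕ → ℕ) → Set
IsAutomorphism Q g h =
  ((x : ℕ) → h (g x) ≡ x) × ((x : ℕ) → g (h x) ≡ x) ×
  ((x y : ℕ) → Q (g x) (g y) ≡ Q x y)

-- Homogeneity: an isomorphism between full subquivers on finite vertex
-- sets {a 0,…,a (n-1)} and {b 0,…,b (n-1)} (given by a k ↦ b k) extends to
-- an automorphism.
IsHomogeneous : RawQuiver ℕ → Set
IsHomogeneous Q =
  (n : ℕ) (a b : Fin n → ℕ) → Injective _≡_ _≡_ a → Injective _≡_ _≡_ b →
  ((k l : Fin n) → Q (a k) (a l) ≡ Q (b k) (b l)) →
  Σ (ℕ → ℕ) λ g → Σ (ℕ → ℕ) λ h →
    IsAutomorphism Q g h × ((k : Fin n) → g (a k) ≡ b k)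

IsUniversal : RawQuiver ℕ → Set
IsUniversal Q =
  (n : ℕ) (q : RawQuiver (Fin n)) → IsQuiver q →
  Σ (Fin n → ℕ) λ f → Injective _≡_ _≡_ f ×
    ((k l : Fin n) → Q (f k) (f l) ≡ q k l)

-- A quiver on ℕ isomorphic to the Fraïssé quiver: a countable homogeneous
-- quiver whose age contains all finite quivers (Fraïssé limit).
IsFraisse : RawQuiver ℕ → Set
IsFraisse F = IsQuiver F × IsHomogeneous F × IsUniversal F

{-# OPTIONS --safe #-}
-- A Fraïssé quiver has the extension property: for every bound B and every
-- prescription p, some vertex y ≥ B has exactly p a arrows from each a < B;
-- mutation preserves this property. Mutating at a vertex x whose arrows from
-- the vertices v ≤ N are c v adds c v [−c w]₊ + [−c v]₊ (−c w) to the arrows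
-- from v to w for v, w ≤ N. If c is sign-coherent on the first N vertices this vanishes there,
-- and choosing c N = ∓1 adds c v to column N. So two mutations, one raising
-- column N above Q's column and one lowering it onto it, extend the agreement
-- with Q from the first N vertices to the first N + 1, and after 2N mutations
-- the quiver agrees with Q on {0,…,N−1}.
module Submission where

open import Defs
open import Data.Product using (Σ)
open import Data.Nat using (ℕ; suc)

open import Data.Nat as ℕ using (zero; _≤_; _<_; _∸_; s≤s; _≟_)
open import Data.Nat.Properties
  using (≤-refl; ≤-trans; n≤1+n; <-≤-trans; <⇒≤; <⇒≢; ≮⇒≥; m≤m+n; m≤n+m; m<1+n⇒m<n∨m≡n; +-suc; m∸n+n≡m)
open import Data.Integer as ℤ using (ℤ; 0ℤ; 1ℤ; -1ℤ; -_; _+_; _-_; _*_; +_; -[1+_])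
open import Data.Integer.Properties
  using (neg-involutive; neg-distrib-+; neg-mono-≤; i≤j⇒i⊔j≡j; i≥j⇒i⊔j≡i; i≤i⊔j; i≤j⊔i;
         i≤j⇒i-j≤0; *-zeroʳ; *-identityʳ; +-identityʳ)
open import Data.Integer.Tactic.RingSolver using (solve-∀)
open import Data.Fin using (Fin; toℕ; fromℕ; fromℕ<; inject₁)
open import Data.Fin.Properties
  using (toℕ-injective; toℕ<n; toℕ-fromℕ; toℕ-fromℕ<; toℕ-inject₁; inject₁-injective; fromℕ≢inject₁)
open import Data.List.Extrema.Nat using (max; xs≤max)
open import Data.List.Membership.Propositional using (_∈_)
import Data.List.Relation.Unary.All as All
open import Data.Product using (_×_; _,_; proj₁; ∃-syntax; ∃₂)
open import Data.Sum using (_⊎_; inj₁; inj₂)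
open import Function using (_∘_)
open import Function.Definitions using (Injective)
open import Relation.Nullary using (Dec; yes; no; contradiction)
open import Relation.Binary.PropositionalEquality
open ≡-Reasoning

mutationTerm : ℤ → ℤ → ℤ
mutationTerm a b = a * [ b ]₊ + [ - a ]₊ * b

mutationTerm-antisym : ∀ a b → mutationTerm (- b) (- a) ≡ - mutationTerm a b
mutationTerm-antisym a b rewrite neg-involutive b = swap a b [ - a ]₊ [ b ]₊
  where
  swap : ∀ a b s t → - b * s + t * - a ≡ - (a * t + s * b)
  swap = solve-∀

0≤a⇒b≤0⇒mutationTerm≡0 : ∀ {a b} → 0ℤ ℤ.≤ a → b ℤ.≤ 0ℤ → mutationTerm a b ≡ 0ℤ
0≤a⇒b≤0⇒mutationTerm≡0 {a} 0≤a b≤0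
  rewrite i≤j⇒i⊔j≡j b≤0 | i≤j⇒i⊔j≡j (neg-mono-≤ 0≤a) | *-zeroʳ a = refl

a≤0⇒0≤b⇒mutationTerm≡0 : ∀ {a b} → a ℤ.≤ 0ℤ → 0ℤ ℤ.≤ b → mutationTerm a b ≡ 0ℤ
a≤0⇒0≤b⇒mutationTerm≡0 {a} {b} a≤0 0≤b
  rewrite i≥j⇒i⊔j≡i 0≤b | i≥j⇒i⊔j≡i (neg-mono-≤ a≤0) = cancel a b
  where
  cancel : ∀ a b → a * b + - a * b ≡ 0ℤ
  cancel = solve-∀

0≤a⇒mutationTerm[a,1]≡a : ∀ {a} → 0ℤ ℤ.≤ a → mutationTerm a 1ℤ ≡ a
0≤a⇒mutationTerm[a,1]≡a {a} 0≤a
  rewrite i≤j⇒i⊔j≡j (neg-mono-≤ 0≤a) | *-identityʳ a = +-identityʳ a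

a≤0⇒mutationTerm[a,-1]≡a : ∀ {a} → a ℤ.≤ 0ℤ → mutationTerm a -1ℤ ≡ a
a≤0⇒mutationTerm[a,-1]≡a {a} a≤0
  rewrite i≥j⇒i⊔j≡i (neg-mono-≤ a≤0) = simplify a
  where
  simplify : ∀ a → a * 0ℤ + - a * -1ℤ ≡ a
  simplify = solve-∀

μ-away : ∀ x G {v w} → v ≢ x → w ≢ x →
         μ x G v w ≡ G v w + mutationTerm (G v x) (G x w)
μ-away x G {v} {w} v≢x w≢x with v ≟ x | w ≟ x
... | yes v≡x | _       = contradiction v≡x v≢x
... | no _    | yes w≡x = contradiction w≡x w≢x
... | no _    | no _    = refl

μ-source : ∀ x G w → μ x G x w ≡ - G x w
μ-source x G w with x ≟ x
... | yes _   = refl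
... | no x≢x = contradiction refl x≢x

μ-isQuiver : ∀ x {G} → IsQuiver G → IsQuiver (μ x G)
μ-isQuiver x {G} isQuiverG v w with v ≟ x | w ≟ x
... | yes _ | yes _ = cong -_ (isQuiverG v w)
... | yes _ | no _  = cong -_ (isQuiverG v w)
... | no _  | yes _ = cong -_ (isQuiverG v w)
... | no _  | no _  = begin
  G v w + mutationTerm (G v x) (G x w)         ≡⟨ cong₂ (λ a b → G v w + mutationTerm a b) (isQuiverG v x) (isQuiverG x w) ⟩
  G v w + mutationTerm (- G x v) (- G w x)     ≡⟨ cong₂ _+_ (isQuiverG v w) (mutationTerm-antisym (G w x) (G x v)) ⟩
  - G w v + - mutationTerm (G w x) (G x v)     ≡⟨ neg-distrib-+ (G w v) _ ⟨
  - (G w v + mutationTerm (G w x) (G x v))     ∎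

isQuiver⇒loopless : ∀ {X} {G : RawQuiver X} → IsQuiver G → ∀ v → G v v ≡ 0ℤ
isQuiver⇒loopless {G = G} isQuiverG v = self-negating (G v v) (isQuiverG v v)
  where
  self-negating : ∀ a → a ≡ - a → a ≡ 0ℤ
  self-negating (+ zero)  _  = refl
  self-negating (+ suc n) ()
  self-negating -[1+ n ]  ()

_[_]≔_ : {A : Set} → (ℕ → A) → ℕ → A → ℕ → A
(f [ n ]≔ b) u with u ≟ n
... | yes _ = b
... | no _  = f u

[]≔-updates : ∀ {A : Set} (f : ℕ → A) n b → (f [ n ]≔ b) n ≡ b
[]≔-updates f n b with n ≟ n
... | yes _   = refl
... | no n≢n = contradiction refl n≢n

[]≔-minimal : ∀ {A : Set} (f : ℕ → A) {n} b {u} → u ≢ n → (f [ n ]≔ b) u ≡ f u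
[]≔-minimal f {n} b {u} u≢n with u ≟ n
... | yes u≡n = contradiction u≡n u≢n
... | no _    = refl

ExtensionProperty : RawQuiver ℕ → Set
ExtensionProperty G =
  (B : ℕ) (p : ℕ → ℤ) → ∃[ y ] (B ≤ y × (∀ a → a < B → G a y ≡ p a))

-- The new vertex is chosen so that mutation at x turns its arrows into p.
μ-extensionProperty : ∀ x {G} → ExtensionProperty G → ExtensionProperty (μ x G)
μ-extensionProperty x {G} extG B p
  with extG (suc x ℕ.+ B) ((λ a → p a - mutationTerm (G a x) (- p x)) [ x ]≔ (- p x))
... | y , x+B<y , G-y = y , ≤-trans (m≤n+m B (suc x)) x+B<y , realises
  where
  x<y : x < y
  x<y = <-≤-trans (s≤s (m≤m+n x B)) x+B<y

  G[x,y] : G x y ≡ - p x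
  G[x,y] = trans (G-y x (s≤s (m≤m+n x B))) ([]≔-updates _ x _)

  realises-x : μ x G x y ≡ p x
  realises-x = trans (μ-source x G y) (trans (cong -_ G[x,y]) (neg-involutive (p x)))

  realises-away : ∀ {a} → a < B → a ≢ x → μ x G a y ≡ p a
  realises-away {a} a<B a≢x = begin
    μ x G a y                                   ≡⟨ μ-away x G a≢x (<⇒≢ x<y ∘ sym) ⟩
    G a y + mutationTerm (G a x) (G x y)        ≡⟨ cong₂ (λ b c → b + mutationTerm (G a x) c) G[a,y] G[x,y] ⟩
    (p a - t) + t                               ≡⟨ cancel (p a) t ⟩
    p a                                         ∎
    where
    t = mutationTerm (G a x) (- p x)
    G[a,y] : G a y ≡ p a - t
    G[a,y] = trans (G-y a (<-≤-trans a<B (m≤n+m B (suc x)))) ([]≔-minimal _ _ a≢x)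
    cancel : ∀ a t → (a - t) + t ≡ a
    cancel = solve-∀

  realises : ∀ a → a < B → μ x G a y ≡ p a
  realises a a<B = byCases (a ≟ x)
    where
    byCases : Dec (a ≡ x) → μ x G a y ≡ p a
    byCases (yes refl) = realises-x
    byCases (no a≢x)   = realises-away a<B a≢x

reattach : RawQuiver ℕ → ℕ → (ℕ → ℤ) → RawQuiver ℕ
reattach G B p u v with u ≟ B | v ≟ B
... | yes _ | yes _ = 0ℤ
... | no _  | yes _ = p u
... | yes _ | no _  = - p v
... | no _  | no _  = G u v

reattach-isQuiver : ∀ {G} → IsQuiver G → ∀ B p → IsQuiver (reattach G B p)
reattach-isQuiver isQuiverG B p u v with u ≟ B | v ≟ B
... | yes _ | yes _ = refl
... | no _  | yes _ = sym (neg-involutive (p u))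
... | yes _ | no _  = refl
... | no _  | no _  = isQuiverG u v

reattach-away : ∀ G B p {u v} → u ≢ B → v ≢ B → reattach G B p u v ≡ G u v
reattach-away G B p {u} {v} u≢B v≢B with u ≟ B | v ≟ B
... | yes u≡B | _       = contradiction u≡B u≢B
... | no _    | yes v≡B = contradiction v≡B v≢B
... | no _    | no _    = refl

reattach-into : ∀ G B p {u} → u ≢ B → reattach G B p u B ≡ p u
reattach-into G B p {u} u≢B with u ≟ B | B ≟ B
... | yes u≡B | _       = contradiction u≡B u≢B
... | no _    | yes _   = refl
... | no _    | no B≢B = contradiction refl B≢B

-- An automorphism moves the copy a back onto {0,…,B−1}; the image of z is the
-- vertex sought.
homogeneous-transport : ∀ {F B} → IsHomogeneous F →
  (a : Fin B → ℕ) → Injective _≡_ _≡_ a → (∀ k l → F (a k) (a l) ≡ F (toℕ k) (toℕ l)) →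
  (z : ℕ) → (∀ k → z ≢ a k) →
  ∃[ y ] (B ≤ y × (∀ k → F (toℕ k) y ≡ F (a k) z))
homogeneous-transport {F} {B} homogeneousF a a-injective a-copies z z-fresh =
  let g , h , (h∘g≗id , _ , g-preserves) , g∘a≗toℕ =
        homogeneousF B a toℕ a-injective toℕ-injective a-copies
      g-injective : ∀ {u v} → g u ≡ g v → u ≡ v
      g-injective {u} {v} gu≡gv = trans (sym (h∘g≗id u)) (trans (cong h gu≡gv) (h∘g≗id v))
      y-fresh : B ≤ g z
      y-fresh = ≮⇒≥ λ gz<B →
        z-fresh (fromℕ< gz<B)
          (g-injective (trans (sym (toℕ-fromℕ< gz<B)) (sym (g∘a≗toℕ (fromℕ< gz<B)))))
      y-realises : ∀ k → F (toℕ k) (g z) ≡ F (a k) z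
      y-realises k = trans (cong (λ u → F u (g z)) (sym (g∘a≗toℕ k))) (g-preserves (a k) z)
  in g z , y-fresh , y-realises

isFraisse⇒extensionProperty : ∀ {F} → IsFraisse F → ExtensionProperty F
isFraisse⇒extensionProperty {F} (isQuiverF , homogeneousF , universalF) B p =
  let E = reattach F B p
      f , f-injective , f-embeds =
        universalF (suc B) (λ k l → E (toℕ k) (toℕ l))
          (λ k l → reattach-isQuiver isQuiverF B p (toℕ k) (toℕ l))
      old : ∀ k → toℕ k ≢ B
      old k = <⇒≢ (toℕ<n k)
      copies : ∀ k l → F (f (inject₁ k)) (f (inject₁ l)) ≡ F (toℕ k) (toℕ l)
      copies k l = begin
        F (f (inject₁ k)) (f (inject₁ l))       ≡⟨ f-embeds (inject₁ k) (inject₁ l) ⟩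
        E (toℕ (inject₁ k)) (toℕ (inject₁ l))   ≡⟨ cong₂ E (toℕ-inject₁ k) (toℕ-inject₁ l) ⟩
        E (toℕ k) (toℕ l)                       ≡⟨ reattach-away F B p (old k) (old l) ⟩
        F (toℕ k) (toℕ l)                       ∎
      y , B≤y , y-realises =
        homogeneous-transport homogeneousF (f ∘ inject₁) (inject₁-injective ∘ f-injective) copies
          (f (fromℕ B)) (λ k → fromℕ≢inject₁ ∘ f-injective)
      realises : ∀ u → u < B → F u y ≡ p u
      realises u u<B = let k = fromℕ< u<B in begin
        F u y                                   ≡⟨ cong (λ v → F v y) (toℕ-fromℕ< u<B) ⟨
        F (toℕ k) y                             ≡⟨ y-realises k ⟩
        F (f (inject₁ k)) (f (fromℕ B))         ≡⟨ f-embeds (inject₁ k) (fromℕ B) ⟩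
        E (toℕ (inject₁ k)) (toℕ (fromℕ B))     ≡⟨ cong₂ E (trans (toℕ-inject₁ k) (toℕ-fromℕ< u<B)) (toℕ-fromℕ B) ⟩
        E u B                                   ≡⟨ reattach-into F B p (<⇒≢ u<B) ⟩
        p u                                     ∎
  in y , B≤y , realises

-- x is supplied by the extension property, with G v x = c v for v ≤ N.
μ-atProfile : ∀ {G} → IsQuiver G → ExtensionProperty G → (N : ℕ) (c : ℕ → ℤ) →
  ∃[ x ] (∀ v w → v ≤ N → w ≤ N → μ x G v w ≡ G v w + mutationTerm (c v) (- c w))
μ-atProfile {G} isQuiverG extG N c with extG (suc N) c
... | x , N<x , G-x = x , λ v w v≤N w≤N → begin
  μ x G v w                               ≡⟨ μ-away x G (below v≤N) (below w≤N) ⟩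
  G v w + mutationTerm (G v x) (G x w)    ≡⟨ cong₂ (λ a b → G v w + mutationTerm a b)
                                                (G-x v (s≤s v≤N)) (trans (isQuiverG x w) (cong -_ (G-x w (s≤s w≤N)))) ⟩
  G v w + mutationTerm (c v) (- c w)      ∎
  where
  below : ∀ {v} → v ≤ N → v ≢ x
  below v≤N = <⇒≢ (<-≤-trans (s≤s v≤N) N<x)

AgreeBelow : ℕ → RawQuiver ℕ → RawQuiver ℕ → Set
AgreeBelow N G H = ∀ v w → v < N → w < N → G v w ≡ H v w

agreeBelow-trans : ∀ {N G H K} → AgreeBelow N G H → AgreeBelow N H K → AgreeBelow N G K
agreeBelow-trans G≈H H≈K v w v<N w<N = trans (G≈H v w v<N w<N) (H≈K v w v<N w<N)

agreeBelow-antitone : ∀ {K N G H} → K ≤ N → AgreeBelow N G H → AgreeBelow K G H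
agreeBelow-antitone K≤N G≈H v w v<K w<K = G≈H v w (<-≤-trans v<K K≤N) (<-≤-trans w<K K≤N)

agreeBelow-suc : ∀ {N G H} → IsQuiver G → IsQuiver H → AgreeBelow N G H →
  (∀ v → v < N → G v N ≡ H v N) → AgreeBelow (suc N) G H
agreeBelow-suc {N} {G} {H} isQuiverG isQuiverH G≈H column v w v<1+N w<1+N
  with m<1+n⇒m<n∨m≡n v<1+N | m<1+n⇒m<n∨m≡n w<1+N
... | inj₁ v<N  | inj₁ w<N  = G≈H v w v<N w<N
... | inj₁ v<N  | inj₂ refl = column v v<N
... | inj₂ refl | inj₁ w<N  =
  trans (isQuiverG N w) (trans (cong -_ (column w w<N)) (sym (isQuiverH N w)))
... | inj₂ refl | inj₂ refl = trans (isQuiver⇒loopless isQuiverG N) (sym (isQuiver⇒loopless isQuiverH N))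

SignCoherentBelow : ℕ → (ℕ → ℤ) → Set
SignCoherentBelow N e = (∀ v → v < N → 0ℤ ℤ.≤ e v) ⊎ (∀ v → v < N → e v ℤ.≤ 0ℤ)

-- Mutate at a vertex with profile e on {0,…,N−1} and s at N.
shiftColumnBy : ∀ {G} → IsQuiver G → ExtensionProperty G → (N : ℕ) (e : ℕ → ℤ) (s : ℤ) →
  (∀ v w → v < N → w < N → mutationTerm (e v) (- e w) ≡ 0ℤ) →
  (∀ v → v < N → mutationTerm (e v) (- s) ≡ e v) →
  ∃[ x ] (AgreeBelow N (μ x G) G × (∀ v → v < N → μ x G v N ≡ G v N + e v))
shiftColumnBy {G} isQuiverG extG N e s vanishes reproduces
  with μ-atProfile isQuiverG extG N (e [ N ]≔ s)
... | x , μ-effect = x , unchanged , shifted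
  where
  c = e [ N ]≔ s

  c≗e : ∀ {v} → v < N → c v ≡ e v
  c≗e v<N = []≔-minimal e s (<⇒≢ v<N)

  unchanged : AgreeBelow N (μ x G) G
  unchanged v w v<N w<N = begin
    μ x G v w                             ≡⟨ μ-effect v w (<⇒≤ v<N) (<⇒≤ w<N) ⟩
    G v w + mutationTerm (c v) (- c w)    ≡⟨ cong₂ (λ a b → G v w + mutationTerm a (- b)) (c≗e v<N) (c≗e w<N) ⟩
    G v w + mutationTerm (e v) (- e w)    ≡⟨ cong (λ d → G v w + d) (vanishes v w v<N w<N) ⟩
    G v w + 0ℤ                            ≡⟨ +-identityʳ (G v w) ⟩
    G v w                                 ∎

  shifted : ∀ v → v < N → μ x G v N ≡ G v N + e v
  shifted v v<N = begin
    μ x G v N                             ≡⟨ μ-effect v N (<⇒≤ v<N) ≤-refl ⟩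
    G v N + mutationTerm (c v) (- c N)    ≡⟨ cong₂ (λ a b → G v N + mutationTerm a (- b)) (c≗e v<N) ([]≔-updates e N s) ⟩
    G v N + mutationTerm (e v) (- s)      ≡⟨ cong (λ d → G v N + d) (reproduces v v<N) ⟩
    G v N + e v                           ∎

shiftColumn : ∀ {G} → IsQuiver G → ExtensionProperty G → (N : ℕ) (e : ℕ → ℤ) →
  SignCoherentBelow N e →
  ∃[ x ] (AgreeBelow N (μ x G) G × (∀ v → v < N → μ x G v N ≡ G v N + e v))
shiftColumn isQuiverG extG N e (inj₁ e≥0) = shiftColumnBy isQuiverG extG N e -1ℤ
  (λ v w v<N w<N → 0≤a⇒b≤0⇒mutationTerm≡0 (e≥0 v v<N) (neg-mono-≤ (e≥0 w w<N)))
  (λ v v<N → 0≤a⇒mutationTerm[a,1]≡a (e≥0 v v<N))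
shiftColumn isQuiverG extG N e (inj₂ e≤0) = shiftColumnBy isQuiverG extG N e 1ℤ
  (λ v w v<N w<N → a≤0⇒0≤b⇒mutationTerm≡0 (e≤0 v v<N) (neg-mono-≤ (e≤0 w w<N)))
  (λ v v<N → a≤0⇒mutationTerm[a,-1]≡a (e≤0 v v<N))

a-[b+[a-b]₊]≤0 : ∀ a b → a - (b + [ a - b ]₊) ℤ.≤ 0ℤ
a-[b+[a-b]₊]≤0 a b = subst (ℤ._≤ 0ℤ) (regroup a b [ a - b ]₊) (i≤j⇒i-j≤0 (i≤i⊔j (a - b) 0ℤ))
  where
  regroup : ∀ a b c → (a - b) - c ≡ a - (b + c)
  regroup = solve-∀

-- Raise column N by the positive part of t − G, then lower it by what is left.
setColumn : ∀ {G} → IsQuiver G → ExtensionProperty G → (N : ℕ) (t : ℕ → ℤ) →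
  ∃₂ λ x₁ x₂ → AgreeBelow N (μ x₁ G) G × AgreeBelow N (μ x₂ (μ x₁ G)) G ×
               (∀ v → v < N → μ x₂ (μ x₁ G) v N ≡ t v)
setColumn {G} isQuiverG extG N t
  with shiftColumn isQuiverG extG N (λ v → [ t v - G v N ]₊) (inj₁ λ v _ → i≤j⊔i (t v - G v N) 0ℤ)
... | x₁ , unchanged₁ , raised
  with shiftColumn (μ-isQuiver x₁ isQuiverG) (μ-extensionProperty x₁ extG) N (λ v → t v - μ x₁ G v N)
         (inj₂ λ v v<N → subst (λ g → t v - g ℤ.≤ 0ℤ) (sym (raised v v<N)) (a-[b+[a-b]₊]≤0 (t v) (G v N)))
... | x₂ , unchanged₂ , lowered =
  x₁ , x₂ , unchanged₁ , agreeBelow-trans unchanged₂ unchanged₁ ,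
  λ v v<N → trans (lowered v v<N) (settle (t v) (μ x₁ G v N))
  where
  settle : ∀ a b → b + (a - b) ≡ a
  settle = solve-∀

interleave : {A : Set} → (ℕ → A) → (ℕ → A) → ℕ → A
interleave f g zero          = f zero
interleave f g (suc zero)    = g zero
interleave f g (suc (suc m)) = interleave (f ∘ suc) (g ∘ suc) m

interleave-even : ∀ {A : Set} (f g : ℕ → A) N → interleave f g (N ℕ.* 2) ≡ f N
interleave-even f g zero    = refl
interleave-even f g (suc N) = interleave-even (f ∘ suc) (g ∘ suc) N

interleave-odd : ∀ {A : Set} (f g : ℕ → A) N → interleave f g (suc (N ℕ.* 2)) ≡ g N
interleave-odd f g zero    = refl
interleave-odd f g (suc N) = interleave-odd (f ∘ suc) (g ∘ suc) N

module Approximation (F Q : RawQuiver ℕ) (isFraisseF : IsFraisse F) (isQuiverQ : IsQuiver Q) where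

  record Approximant (N : ℕ) : Set where
    field
      quiver            : RawQuiver ℕ
      isQuiver          : IsQuiver quiver
      extensionProperty : ExtensionProperty quiver
      agrees            : AgreeBelow N quiver Q

  record Refinement {N} (A : Approximant N) : Set where
    field
      first second  : ℕ
      next          : Approximant (suc N)
      next-quiver   : Approximant.quiver next ≡ μ second (μ first (Approximant.quiver A))
      midway-agrees : AgreeBelow N (μ first (Approximant.quiver A)) Q

  refine : ∀ {N} (A : Approximant N) → Refinement A
  refine {N} A
    with setColumn (Approximant.isQuiver A) (Approximant.extensionProperty A) N (λ v → Q v N)
  ... | x₁ , x₂ , unchanged₁ , unchanged₂ , column = record
    { first         = x₁
    ; second        = x₂
    ; next          = record
      { quiver            = μ x₂ (μ x₁ quiver)
      ; isQuiver          = isQuiver₂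
      ; extensionProperty = μ-extensionProperty x₂ (μ-extensionProperty x₁ extensionProperty)
      ; agrees            = agreeBelow-suc isQuiver₂ isQuiverQ (agreeBelow-trans unchanged₂ agrees) column
      }
    ; next-quiver   = refl
    ; midway-agrees = agreeBelow-trans unchanged₁ agrees
    }
    where
    open Approximant A
    isQuiver₂ : IsQuiver (μ x₂ (μ x₁ quiver))
    isQuiver₂ = μ-isQuiver x₂ (μ-isQuiver x₁ isQuiver)

  approximant : (N : ℕ) → Approximant N
  approximant zero = record
    { quiver            = F
    ; isQuiver          = proj₁ isFraisseF
    ; extensionProperty = isFraisse⇒extensionProperty isFraisseF
    ; agrees            = λ _ _ ()
    }
  approximant (suc N) = Refinement.next (refine (approximant N))

  refinement : (N : ℕ) → Refinement (approximant N)
  refinement N = refine (approximant N)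

  schedule : ℕ → ℕ
  schedule = interleave (Refinement.first ∘ refinement) (Refinement.second ∘ refinement)

  mutSeq-approximant : ∀ N → mutSeq F schedule (N ℕ.* 2) ≡ Approximant.quiver (approximant N)
  mutSeq-approximant zero    = refl
  mutSeq-approximant (suc N) = begin
    μ (schedule (suc (N ℕ.* 2))) (μ (schedule (N ℕ.* 2)) (mutSeq F schedule (N ℕ.* 2)))
      ≡⟨ cong₂ μ (interleave-odd _ _ N) (cong₂ μ (interleave-even _ _ N) (mutSeq-approximant N)) ⟩
    μ (Refinement.second (refinement N)) (μ (Refinement.first (refinement N)) (Approximant.quiver (approximant N)))
      ≡⟨ Refinement.next-quiver (refinement N) ⟨
    Approximant.quiver (approximant (suc N))
      ∎

  mutSeq-agreesBelow : ∀ k N → AgreeBelow N (mutSeq F schedule (k ℕ.+ N ℕ.* 2)) Q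
  mutSeq-agreesBelow zero N =
    subst (λ G → AgreeBelow N G Q) (sym (mutSeq-approximant N)) (Approximant.agrees (approximant N))
  mutSeq-agreesBelow (suc zero) N =
    subst (λ G → AgreeBelow N G Q)
      (sym (cong₂ μ (interleave-even _ _ N) (mutSeq-approximant N)))
      (Refinement.midway-agrees (refinement N))
  mutSeq-agreesBelow (suc (suc k)) N =
    subst (λ m → AgreeBelow N (mutSeq F schedule m) Q) (trans (+-suc k _) (cong suc (+-suc k _)))
      (agreeBelow-antitone (n≤1+n N) (mutSeq-agreesBelow k (suc N)))

  schedule-converges : ConvergesTo (λ m → mutSeq F schedule (suc m)) Q
  schedule-converges V = K ℕ.* 2 , λ m K*2≤m x y x∈V y∈V →
    subst (λ m′ → AgreeBelow K (mutSeq F schedule m′) Q) (cong suc (m∸n+n≡m K*2≤m))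
      (mutSeq-agreesBelow (suc (m ∸ K ℕ.* 2)) K) x y (bounded x∈V) (bounded y∈V)
    where
    K = suc (max 0 V)
    bounded : ∀ {x} → x ∈ V → x < K
    bounded x∈V = s≤s (All.lookup (xs≤max 0 V) x∈V)

theorem1p6 : (F Q : RawQuiver ℕ) → IsFraisse F → IsQuiver Q →
    Σ (ℕ → ℕ) λ i → ConvergesTo (λ m → mutSeq F i (suc m)) Q
theorem1p6 F Q isFraisseF isQuiverQ = schedule , schedule-converges
  where open Approximation F Q isFraisseF isQuiverQ
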